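{- For all integers $n,m\ge 2$, the $n\times m$ grid graph $\Gamma_{n,m}$ has inspection number $\mathsf{in}(\Gamma_{n,m})=\min\{n,m\}+1$.
   Context: $\Gamma_{n,m}$ has vertex set $\{(i,j)\in\mathbb Z^2: 0\le i<n,\ 0\le j<m\}$, with $(a,b)$ and $(c,d)$ adjacent iff $|a-c|+|b-d|=1$. Zero-visibility $k$-search game on a finite simple graph $G$: an invisible intruder occupies a vertex; players alternate starting with the searcher; on each turn the searcher inspects an arbitrary set of $k$ vertices and wins if the intruder is at one of them; otherwise the intruder may move to an adjacent vertex or stay. The inspection number $\mathsf{in}(G)$ is the least $k$ for which the searcher has a finite sequence of moves guaranteeing capture regardless of the intruder's start and moves. -}

module Defs where

open import Level using (Level; _⊔_) renaming (suc to lsuc)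
open import Data.Nat using (ℕ; suc; _+_; _≤_; ∣_-_∣)
open import Data.Fin using (Fin; toℕ)
open import Data.Product using (Σ; ∃; ∃-syntax; _×_; _,_)
open import Data.Sum using (_⊎_)
open import Relation.Binary.PropositionalEquality using (_≡_)
open import Function.Definitions using (Injective)

record Graph : Set₁ where
  field
    V   : Set
    Adj : V → V → Set

open Graph public

Grid : ℕ → ℕ → Graph
Grid n m = record
  { V   = Fin n × Fin m
  ; Adj = λ { (a , b) (c , d) → ∣ toℕ a - toℕ c ∣ + ∣ toℕ b - toℕ d ∣ ≡ 1 }
  }

record Inspection (G : Graph) (k : ℕ) : Set where
  field
    pick     : Fin k → V G
    distinct : Injective _≡_ _≡_ pick

open Inspection public

-- A searcher strategy (zero visibility: a fixed finite sequence of inspections).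
record Strategy (G : Graph) (k : ℕ) : Set where
  field
    len   : ℕ
    round : Fin len → Inspection G k

open Strategy public

-- An intruder trajectory: position w t when the searcher makes its t-th
-- inspection; between inspections the intruder stays or moves to a neighbour.
IsWalk : (G : Graph) → (ℕ → V G) → Set
IsWalk G w = ∀ t → w (suc t) ≡ w t ⊎ Adj G (w t) (w (suc t))

Catches : (G : Graph) {k : ℕ} → Strategy G k → (ℕ → V G) → Set
Catches G σ w = ∃[ t ] ∃[ i ] pick (round σ t) i ≡ w (toℕ t)

SearcherWins : Graph → ℕ → Set
SearcherWins G k = Σ (Strategy G k) λ σ → ∀ w → IsWalk G w → Catches G σ w

IsInspectionNumber : Graph → ℕ → Set
IsInspectionNumber G k = SearcherWins G k × (∀ j → SearcherWins G j → k ≤ j)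

-- Let n ≤ m.  Upper bound: number the vertices (a , b) column by column, by n * b + a.  A move
-- changes this index by at most n, so inspecting the indices t, …, t + n in round t sweeps the
-- grid: an intruder who is never caught keeps an index ≥ t, which fails in the last round.
-- Lower bound: against k ≤ n inspections, the positions of an intruder not yet caught start as
-- all n * m ≥ n(n+1)/2 vertices, lose at most n per round and then grow to their closed
-- neighbourhood.  By a vertex-isoperimetric inequality (at least n(n-1)/2 vertices have a closed
-- neighbourhood of at least n(n+1)/2) this set never empties, and tracing a surviving position
-- backwards gives an evading walk.  The inequality is proved on the column counts y j of the set
-- and h j of its neighbourhood.  A column that is neither empty nor full grows, and between
-- neighbouring columns y can only rise by what h pays for; so the excess ∑ (h j - y j) is at
-- least n unless there is an empty but no full column, or a full but no empty column.  In these
-- cases, for each threshold w the columns with y ≥ w (resp. y < w) and the climb from the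
-- nearest empty column (resp. to the nearest full one) are paid from the excess, and summing
-- over w (layer-cake) gives ∑ y < n(n-1)/2, resp. ∑ y ≥ n(n+1)/2.

module Submission where

open import Defs
open import Data.Bool using (Bool; true; false; T; _∧_; _∨_; not)
open import Data.Bool.Properties using (T-∨; T-∧; T-≡)
open import Data.Empty using (⊥-elim)
open import Data.Fin using (Fin; zero; suc; toℕ; fromℕ<; combine; remQuot)
open import Data.Fin.Properties using (toℕ-fromℕ<; fromℕ<-toℕ; toℕ<n; toℕ-injective; remQuot-combine; combine-remQuot; toℕ-combine)
open import Data.Nat
open import Data.Nat.Properties
open import Algebra.Properties.CommutativeSemigroup +-commutativeSemigroup using (interchange)
open import Data.Nat.Solver using (module +-*-Solver)
open import Data.Product using (∃; ∃-syntax; _×_; _,_; proj₁; proj₂; swap)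
open import Data.Product.Properties using (×-≡,≡→≡)
open import Data.Sum using (_⊎_; inj₁; inj₂)
open import Data.Unit using (tt)
open import Function using (_∘_)
open import Function.Bundles using (Equivalence)
open import Relation.Binary.Definitions using (tri<; tri≈; tri>)
open import Relation.Binary.PropositionalEquality
open import Relation.Nullary using (Dec; yes; no; ¬_; ¬?)
open import Relation.Nullary.Decidable using (_×-dec_; T?)
open import Relation.Unary using (Decidable)
open import Relation.Unary.Properties using (∅?)


∑< : ℕ → (ℕ → ℕ) → ℕ
∑< zero    f = 0
∑< (suc n) f = ∑< n f + f n

syntax ∑< n (λ i → e) = ∑[ i < n ] e

⟦_⟧ : Bool → ℕ
⟦ true ⟧  = 1
⟦ false ⟧ = 0

⟦⟧≤1 : ∀ b → ⟦ b ⟧ ≤ 1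
⟦⟧≤1 true  = ≤-refl
⟦⟧≤1 false = z≤n

𝟙 : {P : Set} → Dec P → ℕ
𝟙 (yes _) = 1
𝟙 (no _)  = 0

𝟙≤1 : ∀ {P : Set} (d : Dec P) → 𝟙 d ≤ 1
𝟙≤1 (yes _) = ≤-refl
𝟙≤1 (no _)  = z≤n

∑-cong : ∀ n {f g : ℕ → ℕ} → (∀ {i} → i < n → f i ≡ g i) → ∑< n f ≡ ∑< n g
∑-cong zero    eq = refl
∑-cong (suc n) eq = cong₂ _+_ (∑-cong n (λ i<n → eq (m≤n⇒m≤1+n i<n))) (eq ≤-refl)

∑-mono : ∀ n {f g : ℕ → ℕ} → (∀ {i} → i < n → f i ≤ g i) → ∑< n f ≤ ∑< n g
∑-mono zero    le = z≤n
∑-mono (suc n) le = +-mono-≤ (∑-mono n (λ i<n → le (m≤n⇒m≤1+n i<n))) (le ≤-refl)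

∑-distrib-+ : ∀ n (f g : ℕ → ℕ) → ∑[ i < n ] (f i + g i) ≡ ∑< n f + ∑< n g
∑-distrib-+ zero    f g = refl
∑-distrib-+ (suc n) f g =
  trans (cong (_+ (f n + g n)) (∑-distrib-+ n f g)) (interchange (∑< n f) (∑< n g) (f n) (g n))

∑-const : ∀ n c → ∑[ i < n ] c ≡ n * c
∑-const zero    c = refl
∑-const (suc n) c = trans (cong (_+ c) (∑-const n c)) (+-comm (n * c) c)

∑-zero : ∀ n → ∑[ i < n ] 0 ≡ 0
∑-zero n = trans (∑-const n 0) (*-zeroʳ n)

∑-ones : ∀ n → ∑[ i < n ] 1 ≡ n
∑-ones n = trans (∑-const n 1) (*-identityʳ n)

∑-swap : ∀ n m (f : ℕ → ℕ → ℕ) → ∑[ i < n ] ∑[ j < m ] f i j ≡ ∑[ j < m ] ∑[ i < n ] f i j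
∑-swap zero    m f = sym (∑-zero m)
∑-swap (suc n) m f = begin
  ∑[ i < n ] ∑[ j < m ] f i j + ∑[ j < m ] f n j   ≡⟨ cong (_+ ∑[ j < m ] f n j) (∑-swap n m f) ⟩
  ∑[ j < m ] ∑[ i < n ] f i j + ∑[ j < m ] f n j   ≡⟨ ∑-distrib-+ m (λ j → ∑[ i < n ] f i j) (f n) ⟨
  ∑[ j < m ] (∑[ i < n ] f i j + f n j)            ∎
  where open ≡-Reasoning

∑-reverse : ∀ n (f : ℕ → ℕ) → ∑[ i < n ] f (n ∸ suc i) ≡ ∑< n f
∑-reverse zero    f = refl
∑-reverse (suc n) f = begin
  ∑[ i < suc n ] f (n ∸ i)        ≡⟨ ∑-first n (λ i → f (n ∸ i)) ⟩
  f n + ∑[ i < n ] f (n ∸ suc i)  ≡⟨ cong (f n +_) (∑-reverse n f) ⟩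
  f n + ∑< n f                    ≡⟨ +-comm (f n) _ ⟩
  ∑< n f + f n                    ∎
  where
  open ≡-Reasoning
  ∑-first : ∀ n (g : ℕ → ℕ) → ∑< (suc n) g ≡ g 0 + ∑[ i < n ] g (suc i)
  ∑-first zero    g = +-comm 0 (g 0)
  ∑-first (suc n) g = trans (cong (_+ g (suc n)) (∑-first n g)) (+-assoc (g 0) _ _)

∑-point : ∀ n {a} {f : ℕ → ℕ} → (∀ {i} → i ≢ a → f i ≡ 0) → ∑< n f ≤ f a
∑-point zero    vanishes = z≤n
∑-point (suc n) {a} {f} vanishes with n ≟ a
... | yes refl = ≤-reflexive (cong (_+ f n) (trans (∑-cong n (λ i<n → vanishes (<⇒≢ i<n))) (∑-zero n)))
... | no n≢a   = ≤-trans (≤-reflexive (trans (cong (∑< n f +_) (vanishes n≢a)) (+-identityʳ _)))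
                         (∑-point n vanishes)

∑-strict-mono : ∀ n {f g : ℕ → ℕ} {p} → (∀ {i} → i < n → f i ≤ g i) → p < n → f p < g p →
                ∑< n f < ∑< n g
∑-strict-mono (suc n) le p<1+n fp<gp with m≤n⇒m<n∨m≡n (s≤s⁻¹ p<1+n)
... | inj₁ p<n = +-mono-<-≤ (∑-strict-mono n (λ i<n → le (m≤n⇒m≤1+n i<n)) p<n fp<gp) (le ≤-refl)
... | inj₂ refl = +-mono-≤-< (∑-mono n (λ i<n → le (m≤n⇒m≤1+n i<n))) fp<gp

∑-positive : ∀ n (f : ℕ → ℕ) → 0 < ∑< n f → ∃[ i ] (i < n × 0 < f i)
∑-positive (suc n) f pos with f n in eq
... | suc _ = n , ≤-refl , subst (0 <_) (sym eq) z<s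
... | zero  with ∑-positive n f (subst (0 <_) (+-identityʳ (∑< n f)) pos)
...   | i , i<n , fi>0 = i , m≤n⇒m≤1+n i<n , fi>0


module _ {P : ℕ → Set} (P? : Decidable P) where

  first-switch : ∀ {a b} → a < b → ¬ P a → P b →
                 ∃[ j ] (a ≤ j × j < b × P (suc j) × (∀ {i} → a ≤ i → i ≤ j → ¬ P i))
  first-switch a<b ¬Pa Pb with m≤n⇒∃[o]m+o≡n a<b
  ... | d , refl = search d ¬Pa Pb
    where
    only : ∀ {a i} → ¬ P a → a ≤ i → i ≤ a → ¬ P i
    only ¬Pa a≤i i≤a rewrite ≤-antisym a≤i i≤a = ¬Pa
    search : ∀ d {a} → ¬ P a → P (suc (a + d)) →
             ∃[ j ] (a ≤ j × j < suc (a + d) × P (suc j) × (∀ {i} → a ≤ i → i ≤ j → ¬ P i))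
    search zero {a} ¬Pa Pb = a , ≤-refl , s≤s (m≤m+n a 0) , subst P (cong suc (+-identityʳ a)) Pb , only ¬Pa
    search (suc d) {a} ¬Pa Pb with P? (suc a)
    ... | yes P1+a = a , ≤-refl , s≤s (m≤m+n a _) , P1+a , only ¬Pa
    ... | no ¬P1+a with search d ¬P1+a (subst P (cong suc (+-suc a d)) Pb)
    ...   | j , 1+a≤j , j<b , Pj+1 , before =
            j , ≤-trans (n≤1+n a) 1+a≤j , subst (j <_) (cong suc (sym (+-suc a d))) j<b , Pj+1 , before′
      where
      before′ : ∀ {i} → a ≤ i → i ≤ j → ¬ P i
      before′ a≤i i≤j with m≤n⇒m<n∨m≡n a≤i
      ... | inj₁ a<i  = before a<i i≤j
      ... | inj₂ refl = ¬Pa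

  last-switch : ∀ {a} b → a < b → P a → ¬ P b →
                ∃[ j ] (a ≤ j × j < b × P j × (∀ {i} → j < i → i ≤ b → ¬ P i))
  last-switch {a} (suc b) a<1+b Pa ¬P1+b with P? b
  ... | yes Pb = b , s≤s⁻¹ a<1+b , ≤-refl , Pb , only-1+b
    where
    only-1+b : ∀ {i} → b < i → i ≤ suc b → ¬ P i
    only-1+b b<i i≤1+b rewrite ≤-antisym i≤1+b b<i = ¬P1+b
  ... | no ¬Pb with m≤n⇒m<n∨m≡n (s≤s⁻¹ a<1+b)
  ...   | inj₂ refl = ⊥-elim (¬Pb Pa)
  ...   | inj₁ a<b with last-switch b a<b Pa ¬Pb
  ...     | j , a≤j , j<b , Pj , after = j , a≤j , m≤n⇒m≤1+n j<b , Pj , after′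
    where
    after′ : ∀ {i} → j < i → i ≤ suc b → ¬ P i
    after′ j<i i≤1+b with m≤n⇒m<n∨m≡n i≤1+b
    ... | inj₁ i<1+b = after j<i (s≤s⁻¹ i<1+b)
    ... | inj₂ refl  = ¬P1+b

∸-triangle : ∀ x y z → x ∸ z ≤ (y ∸ z) + (x ∸ y)
∸-triangle x       y       zero    = m≤n+m∸n x y
∸-triangle zero    y       (suc z) = z≤n
∸-triangle (suc x) zero    (suc z) = ≤-trans (m∸n≤m x z) (n≤1+n x)
∸-triangle (suc x) (suc y) (suc z) = ∸-triangle x y z

_∈[_,_⟩? : ∀ i a b → Dec (a ≤ i × i < b)
i ∈[ a , b ⟩? = a ≤? i ×-dec i <? b

restrict : ℕ → ℕ → (ℕ → ℕ) → ℕ → ℕ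
restrict a b g i with i ∈[ a , b ⟩?
... | yes _ = g i
... | no _  = 0

restrict-inside : ∀ {a b i} (g : ℕ → ℕ) → a ≤ i → i < b → restrict a b g i ≡ g i
restrict-inside {a} {b} {i} g a≤i i<b with i ∈[ a , b ⟩?
... | yes _ = refl
... | no ∉ = ⊥-elim (∉ (a≤i , i<b))

restrict-extend : ∀ {a b i} (g : ℕ → ℕ) → i < b → restrict a b g i ≡ restrict a (suc b) g i
restrict-extend {a} {b} {i} g i<b with i ∈[ a , b ⟩? | i ∈[ a , suc b ⟩?
... | yes _           | yes _ = refl
... | no _            | no _  = refl
... | yes (a≤i , i<b) | no ∉  = ⊥-elim (∉ (a≤i , m≤n⇒m≤1+n i<b))
... | no ∉            | yes (a≤i , _) = ⊥-elim (∉ (a≤i , i<b))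

telescope : ∀ m {a b} (Y g : ℕ → ℕ) → a ≤ b → b ≤ m →
            (∀ {i} → a ≤ i → i < b → Y (suc i) ∸ Y i ≤ g i) →
            Y b ∸ Y a ≤ ∑[ i < m ] restrict a b g i
telescope zero    Y g z≤n z≤n step = ≤-reflexive (n∸n≡0 (Y 0))
telescope (suc m) {a} {b} Y g a≤b b≤1+m step with m≤n⇒m<n∨m≡n b≤1+m
... | inj₁ b≤m = ≤-trans (telescope m Y g a≤b (s≤s⁻¹ b≤m) step) (m≤m+n _ _)
... | inj₂ refl with m≤n⇒m<n∨m≡n a≤b
...   | inj₂ refl = ≤-trans (≤-reflexive (n∸n≡0 (Y b))) z≤n
...   | inj₁ 1+a≤1+m = begin
  Y (suc m) ∸ Y a
    ≤⟨ ∸-triangle (Y (suc m)) (Y m) (Y a) ⟩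
  (Y m ∸ Y a) + (Y (suc m) ∸ Y m)
    ≤⟨ +-mono-≤ (telescope m Y g a≤m ≤-refl (λ a≤i i<m → step a≤i (m≤n⇒m≤1+n i<m))) (step a≤m ≤-refl) ⟩
  ∑[ i < m ] restrict a m g i + g m
    ≡⟨ cong₂ _+_ (∑-cong m (restrict-extend {a} g)) (sym (restrict-inside g a≤m ≤-refl)) ⟩
  ∑[ i < m ] restrict a (suc m) g i + restrict a (suc m) g m ∎
  where
  open ≤-Reasoning
  a≤m : a ≤ m
  a≤m = s≤s⁻¹ 1+a≤1+m

𝟙-⊎ : ∀ {P Q R : Set} → (P → Q ⊎ R) → (p : Dec P) (q : Dec Q) (r : Dec R) → 𝟙 p ≤ 𝟙 q + 𝟙 r
𝟙-⊎ P⇒Q⊎R (no _)  q       r       = z≤n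
𝟙-⊎ P⇒Q⊎R (yes p) (yes _) r       = s≤s z≤n
𝟙-⊎ P⇒Q⊎R (yes p) (no ¬q) (yes _) = ≤-refl
𝟙-⊎ P⇒Q⊎R (yes p) (no ¬q) (no ¬r) with P⇒Q⊎R p
... | inj₁ q = ⊥-elim (¬q q)
... | inj₂ r = ⊥-elim (¬r r)

∑-𝟙-except : ∀ n {P : ℕ → Set} (P? : Decidable P) j →
             ∑[ i < n ] 𝟙 (P? i) ≤ ∑[ i < n ] 𝟙 (P? i ×-dec ¬? (i ≟ j)) + 1
∑-𝟙-except n P? j = begin
  ∑[ i < n ] 𝟙 (P? i)
    ≤⟨ ∑-mono n (λ {i} _ → 𝟙-⊎ (split i) (P? i) _ (i ≟ j)) ⟩
  ∑[ i < n ] (𝟙 (P? i ×-dec ¬? (i ≟ j)) + 𝟙 (i ≟ j))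
    ≡⟨ ∑-distrib-+ n _ _ ⟩
  ∑[ i < n ] 𝟙 (P? i ×-dec ¬? (i ≟ j)) + ∑[ i < n ] 𝟙 (i ≟ j)
    ≤⟨ +-monoʳ-≤ _ (≤-trans (∑-point n off) (𝟙≤1 (j ≟ j))) ⟩
  ∑[ i < n ] 𝟙 (P? i ×-dec ¬? (i ≟ j)) + 1 ∎
  where
  open ≤-Reasoning
  split : ∀ {P : Set} i → P → (P × i ≢ j) ⊎ i ≡ j
  split i p with i ≟ j
  ... | yes i≡j = inj₂ i≡j
  ... | no i≢j  = inj₁ (p , i≢j)
  off : ∀ {i} → i ≢ j → 𝟙 (i ≟ j) ≡ 0
  off {i} i≢j with i ≟ j
  ... | yes i≡j = ⊥-elim (i≢j i≡j)
  ... | no _    = refl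

-- y j and h j count the cells of a region and of its closed neighbourhood in column j of the
-- grid with m columns of height n.
record NeighbourhoodProfile (n m : ℕ) (y h : ℕ → ℕ) : Set where
  field
    y≤n         : ∀ {j} → j < m → y j ≤ n
    y≤h         : ∀ {j} → j < m → y j ≤ h j
    y<h         : ∀ {j} → j < m → 0 < y j → y j < n → y j < h j
    y[1+j]≤h[j] : ∀ {j} → suc j < m → y (suc j) ≤ h j
    y[j]≤h[1+j] : ∀ {j} → suc j < m → y j ≤ h (suc j)

excess : ℕ → (ℕ → ℕ) → (ℕ → ℕ) → ℕ
excess m y h = ∑[ j < m ] (h j ∸ y j)

reverse : ℕ → (ℕ → ℕ) → ℕ → ℕ
reverse m f j = f (m ∸ suc j)

reverse-< : ∀ {m j} → j < m → m ∸ suc j < m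
reverse-< {suc m} {j} _ = s≤s (m∸n≤m m j)

reverse-anti : ∀ {m i j} → i < j → j < m → m ∸ suc j < m ∸ suc i
reverse-anti i<j j<m = ∸-monoʳ-< (s≤s i<j) j<m

reverse-involutive : ∀ {m j} → j < m → m ∸ suc (m ∸ suc j) ≡ j
reverse-involutive {suc m} j<1+m = m∸[m∸n]≡n (s≤s⁻¹ j<1+m)

reverse-suc : ∀ {m j} → suc j < m → m ∸ suc j ≡ suc (m ∸ suc (suc j))
reverse-suc {suc m} 2+j≤1+m = +-∸-assoc 1 (s≤s⁻¹ 2+j≤1+m)

profile-reverse : ∀ {n m y h} → NeighbourhoodProfile n m y h →
                  NeighbourhoodProfile n m (reverse m y) (reverse m h)
profile-reverse {n} {m} {y} {h} prof = record
  { y≤n         = y≤n ∘ reverse-<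
  ; y≤h         = y≤h ∘ reverse-<
  ; y<h         = y<h ∘ reverse-<
  ; y[1+j]≤h[j] = λ {j} 1+j<m → subst (λ i → y (m ∸ suc (suc j)) ≤ h i) (sym (reverse-suc 1+j<m))
                                  (y[j]≤h[1+j] (subst (_< m) (reverse-suc 1+j<m) (reverse-< (<-trans (n<1+n j) 1+j<m))))
  ; y[j]≤h[1+j] = λ {j} 1+j<m → subst (λ i → y i ≤ h (m ∸ suc (suc j))) (sym (reverse-suc 1+j<m))
                                  (y[1+j]≤h[j] (subst (_< m) (reverse-suc 1+j<m) (reverse-< (<-trans (n<1+n j) 1+j<m))))
  }
  where open NeighbourhoodProfile prof

excess-reverse : ∀ m y h → excess m (reverse m y) (reverse m h) ≡ excess m y h
excess-reverse m y h = ∑-reverse m (λ j → h j ∸ y j)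

module PathBounds {n m y h} (prof : NeighbourhoodProfile n m y h) where
  open NeighbourhoodProfile prof

  -- The columns of [a, b) pay for the climb from y a to y b; each counted column lies outside
  -- them and, being proper, grows by at least one.
  path-bound : ∀ {Q : ℕ → Set} (Q? : Decidable Q) {a b} → a ≤ b → b < m →
               (∀ {j} → j < m → Q j → (0 < y j × y j < n) × ¬ (a ≤ j × j < b)) →
               ∑[ j < m ] 𝟙 (Q? j) + (y b ∸ y a) ≤ excess m y h
  path-bound Q? {a} {b} a≤b b<m counted = begin
    ∑[ j < m ] 𝟙 (Q? j) + (y b ∸ y a)
      ≤⟨ +-monoʳ-≤ _ (telescope m y D a≤b (<⇒≤ b<m) (λ _ _ → ≤-refl)) ⟩
    ∑[ j < m ] 𝟙 (Q? j) + ∑[ j < m ] restrict a b D j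
      ≡⟨ ∑-distrib-+ m _ _ ⟨
    ∑[ j < m ] (𝟙 (Q? j) + restrict a b D j)
      ≤⟨ ∑-mono m pointwise ⟩
    excess m y h ∎
    where
    open ≤-Reasoning
    D : ℕ → ℕ
    D i = y (suc i) ∸ y i
    pointwise : ∀ {j} → j < m → 𝟙 (Q? j) + restrict a b D j ≤ h j ∸ y j
    pointwise {j} j<m with Q? j | j ∈[ a , b ⟩?
    ... | yes Qj | yes inside    = ⊥-elim (proj₂ (counted j<m Qj) inside)
    ... | yes Qj | no _          = let (0<yj , yj<n) = proj₁ (counted j<m Qj)
                                   in m<n⇒0<n∸m (y<h j<m 0<yj yj<n)
    ... | no _   | yes (_ , j<b) = ∸-monoˡ-≤ (y j) (y[1+j]≤h[j] (≤-<-trans j<b b<m))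
    ... | no _   | no _          = z≤n

  full-after-empty : ∀ {z f} → z < f → f < m → y z ≡ 0 → y f ≡ n → n ≤ excess m y h
  full-after-empty {z} {f} z<f f<m yz≡0 yf≡n = begin
    n                                  ≡⟨ cong₂ _∸_ yf≡n yz≡0 ⟨
    y f ∸ y z                          ≤⟨ m≤n+m _ _ ⟩
    ∑[ j < m ] 𝟙 (∅? j) + (y f ∸ y z)  ≤⟨ path-bound ∅? (<⇒≤ z<f) f<m (λ _ ()) ⟩
    excess m y h                       ∎
    where open ≤-Reasoning

  tall-after-empty : (∀ {j} → j < m → y j < n) →
                     ∀ {z k w} → z < k → k < m → y z ≡ 0 → 0 < w → w ≤ y k →
                     ∑[ j < m ] 𝟙 (w ≤? y j) + w ≤ excess m y h
  tall-after-empty none-full {z} {k} {w} z<k k<m yz≡0 0<w w≤yk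
    with first-switch (λ j → w ≤? y j) z<k (λ w≤yz → <⇒≱ 0<w (subst (w ≤_) yz≡0 w≤yz)) w≤yk
  ... | j , z≤j , j<k , w≤y[1+j] , before = begin
    ∑[ j < m ] 𝟙 (w ≤? y j) + w
      ≤⟨ +-monoʳ-≤ _ (subst (λ x → w ≤ y (suc j) ∸ x) (sym yz≡0) w≤y[1+j]) ⟩
    ∑[ j < m ] 𝟙 (w ≤? y j) + (y (suc j) ∸ y z)
      ≤⟨ path-bound (λ j → w ≤? y j) (m≤n⇒m≤1+n z≤j) (<-≤-trans (s≤s j<k) k<m) counted ⟩
    excess m y h ∎
    where
    open ≤-Reasoning
    counted : ∀ {i} → i < m → w ≤ y i → (0 < y i × y i < n) × ¬ (z ≤ i × i < suc j)
    counted i<m w≤yi = (<-≤-trans 0<w w≤yi , none-full i<m) , λ (z≤i , i<1+j) → before z≤i (s≤s⁻¹ i<1+j) w≤yi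

  short-before-full : (∀ {j} → j < m → 0 < y j) →
                      ∀ {q f w} → q < f → f < m → y f ≡ n → y q < w → w ≤ n →
                      ∑[ j < m ] 𝟙 (y j <? w) + n ≤ excess m y h + w
  short-before-full none-empty {q} {f} {w} q<f f<m yf≡n yq<w w≤n
    with last-switch (λ j → y j <? w) f q<f yq<w (λ yf<w → <⇒≱ yf<w (subst (w ≤_) (sym yf≡n) w≤n))
  ... | j , q≤j , j<f , yj<w , after = begin
    ∑[ i < m ] 𝟙 (y i <? w) + n                  ≤⟨ +-monoˡ-≤ n (∑-𝟙-except m (λ i → y i <? w) j) ⟩
    ∑[ i < m ] 𝟙 (Q? i) + 1 + n                  ≡⟨ +-assoc _ 1 n ⟩
    ∑[ i < m ] 𝟙 (Q? i) + suc n                  ≤⟨ +-monoʳ-≤ _ gap ⟩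
    ∑[ i < m ] 𝟙 (Q? i) + ((y f ∸ y j) + w)      ≡⟨ +-assoc (∑[ i < m ] 𝟙 (Q? i)) (y f ∸ y j) w ⟨
    ∑[ i < m ] 𝟙 (Q? i) + (y f ∸ y j) + w        ≤⟨ +-monoˡ-≤ w (path-bound Q? (<⇒≤ j<f) f<m counted) ⟩
    excess m y h + w                             ∎
    where
    open ≤-Reasoning
    Q : ℕ → Set
    Q i = y i < w × i ≢ j
    Q? : Decidable Q
    Q? i = y i <? w ×-dec ¬? (i ≟ j)
    gap : suc n ≤ (y f ∸ y j) + w
    gap = begin
      suc n                       ≡⟨ cong suc (m∸n+n≡m (≤-trans (<⇒≤ yj<w) w≤n)) ⟨
      suc (n ∸ y j + y j)         ≡⟨ +-suc (n ∸ y j) (y j) ⟨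
      n ∸ y j + suc (y j)         ≤⟨ +-mono-≤ (≤-reflexive (cong (_∸ y j) (sym yf≡n))) yj<w ⟩
      (y f ∸ y j) + w             ∎
    counted : ∀ {i} → i < m → Q i → (0 < y i × y i < n) × ¬ (j ≤ i × i < f)
    counted i<m (yi<w , i≢j) =
      (none-empty i<m , <-≤-trans yi<w w≤n) , λ (j≤i , i<f) → after (≤∧≢⇒< j≤i (i≢j ∘ sym)) (<⇒≤ i<f) yi<w

-- The remaining orientation reduces to PathBounds by reading the columns from right to left.
module Orientations {n m y h} (prof : NeighbourhoodProfile n m y h) where
  private
    module F = PathBounds prof
    module R = PathBounds (profile-reverse prof)

    reverse-at : ∀ {j} → j < m → reverse m y (m ∸ suc j) ≡ y j
    reverse-at j<m = cong y (reverse-involutive j<m)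

  empty-and-full : 0 < n → ∀ {z f} → z < m → f < m → y z ≡ 0 → y f ≡ n → n ≤ excess m y h
  empty-and-full 0<n {z} {f} z<m f<m yz≡0 yf≡n with <-cmp z f
  ... | tri< z<f _ _ = F.full-after-empty z<f f<m yz≡0 yf≡n
  ... | tri≈ _ refl _ = ⊥-elim (<⇒≢ 0<n (trans (sym yz≡0) yf≡n))
  ... | tri> _ _ f<z = subst (n ≤_) (excess-reverse m y h)
                         (R.full-after-empty (reverse-anti f<z z<m) (reverse-< f<m)
                                             (trans (reverse-at z<m) yz≡0) (trans (reverse-at f<m) yf≡n))

  tall-columns : (∀ {j} → j < m → y j < n) → ∀ {z k w} → z < m → k < m → y z ≡ 0 → 0 < w → w ≤ y k →
                 ∑[ j < m ] 𝟙 (w ≤? y j) + w ≤ excess m y h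
  tall-columns none-full {z} {k} {w} z<m k<m yz≡0 0<w w≤yk with <-cmp z k
  ... | tri< z<k _ _ = F.tall-after-empty none-full z<k k<m yz≡0 0<w w≤yk
  ... | tri≈ _ refl _ = ⊥-elim (<⇒≱ 0<w (subst (w ≤_) yz≡0 w≤yk))
  ... | tri> _ _ k<z = subst₂ (λ c e → c + w ≤ e) (∑-reverse m (λ j → 𝟙 (w ≤? y j))) (excess-reverse m y h)
                         (R.tall-after-empty (none-full ∘ reverse-<) (reverse-anti k<z z<m) (reverse-< k<m)
                                             (trans (reverse-at z<m) yz≡0) 0<w (subst (w ≤_) (sym (reverse-at k<m)) w≤yk))

  short-columns : (∀ {j} → j < m → 0 < y j) → ∀ {q f w} → q < m → f < m → y f ≡ n → y q < w → w ≤ n →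
                  ∑[ j < m ] 𝟙 (y j <? w) + n ≤ excess m y h + w
  short-columns none-empty {q} {f} {w} q<m f<m yf≡n yq<w w≤n with <-cmp q f
  ... | tri< q<f _ _ = F.short-before-full none-empty q<f f<m yf≡n yq<w w≤n
  ... | tri≈ _ refl _ = ⊥-elim (<⇒≱ yq<w (subst (w ≤_) (sym yf≡n) w≤n))
  ... | tri> _ _ f<q = subst₂ (λ c e → c + n ≤ e + w) (∑-reverse m (λ j → 𝟙 (y j <? w))) (excess-reverse m y h)
                         (R.short-before-full (none-empty ∘ reverse-<) (reverse-anti f<q q<m) (reverse-< f<m)
                                              (trans (reverse-at f<m) yf≡n) (subst (_< w) (sym (reverse-at q<m)) yq<w) w≤n)

triangle : ℕ → ℕ
triangle n = ∑[ v < n ] v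

∑1+v≡triangle+n : ∀ n → ∑[ v < n ] suc v ≡ triangle n + n
∑1+v≡triangle+n zero    = refl
∑1+v≡triangle+n (suc n) = cong (_+ suc n) (∑1+v≡triangle+n n)

triangle-positive : ∀ {n} → 2 ≤ n → 0 < triangle n
triangle-positive {suc (suc n)} (s≤s (s≤s _)) = <-≤-trans z<s (m≤n+m (suc n) (triangle (suc n)))

triangle+n≤n*n : ∀ n → triangle n + n ≤ n * n
triangle+n≤n*n n = begin
  triangle n + n      ≡⟨ ∑1+v≡triangle+n n ⟨
  ∑[ v < n ] suc v    ≤⟨ ∑-mono n (λ v<n → v<n) ⟩
  ∑[ v < n ] n        ≡⟨ ∑-const n n ⟩
  n * n               ∎
  where open ≤-Reasoning

∑n∸v≡triangle+n : ∀ n → ∑[ v < n ] (n ∸ v) ≡ triangle n + n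
∑n∸v≡triangle+n n = begin
  ∑[ v < n ] (n ∸ v)            ≡⟨ ∑-cong n (λ v<n → +-∸-assoc 1 v<n) ⟩
  ∑[ v < n ] suc (n ∸ suc v)    ≡⟨ ∑-reverse n suc ⟩
  ∑[ v < n ] suc v              ≡⟨ ∑1+v≡triangle+n n ⟩
  triangle n + n                ∎
  where open ≡-Reasoning

∑n∸1+v≡triangle : ∀ n → ∑[ v < suc n ] (n ∸ suc v) ≡ triangle n
∑n∸1+v≡triangle n = begin
  ∑[ v < n ] (n ∸ suc v) + (n ∸ suc n)  ≡⟨ cong₂ _+_ (∑-reverse n (λ v → v)) (m≤n⇒m∸n≡0 (n≤1+n n)) ⟩
  triangle n + 0                        ≡⟨ +-identityʳ _ ⟩
  triangle n                            ∎
  where open ≡-Reasoning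

∑-threshold : ∀ n x → ∑[ v < n ] 𝟙 (suc v ≤? x) ≡ n ⊓ x
∑-threshold zero    x = refl
∑-threshold (suc n) x with suc n ≤? x
... | yes 1+n≤x = trans (cong (_+ 1) (trans (∑-threshold n x) (m≤n⇒m⊓n≡m (<⇒≤ 1+n≤x))))
                        (trans (+-comm n 1) (sym (m≤n⇒m⊓n≡m 1+n≤x)))
... | no 1+n≰x  = trans (cong (_+ 0) (trans (∑-threshold n x) (m≥n⇒m⊓n≡n x≤n)))
                        (trans (+-identityʳ x) (sym (m≥n⇒m⊓n≡n (m≤n⇒m≤1+n x≤n))))
  where
  x≤n : x ≤ n
  x≤n = s≤s⁻¹ (≰⇒> 1+n≰x)

layer-cake : ∀ n m (y : ℕ → ℕ) → (∀ {j} → j < m → y j ≤ n) →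
             ∑< m y ≡ ∑[ v < n ] ∑[ j < m ] 𝟙 (suc v ≤? y j)
layer-cake n m y y≤n = begin
  ∑< m y                                 ≡⟨ ∑-cong m (λ j<m → sym (trans (∑-threshold n _) (m≥n⇒m⊓n≡n (y≤n j<m)))) ⟩
  ∑[ j < m ] ∑[ v < n ] 𝟙 (suc v ≤? y j)  ≡⟨ ∑-swap m n _ ⟩
  ∑[ v < n ] ∑[ j < m ] 𝟙 (suc v ≤? y j)  ∎
  where open ≡-Reasoning

𝟙-complement : ∀ w x → 𝟙 (w ≤? x) + 𝟙 (x <? w) ≡ 1
𝟙-complement w x with w ≤? x | x <? w
... | yes w≤x | yes x<w = ⊥-elim (<⇒≱ x<w w≤x)
... | yes _   | no _    = refl
... | no _    | yes _   = refl
... | no w≰x  | no x≮w  = ⊥-elim (w≰x (≮⇒≥ x≮w))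

∑-𝟙-none : ∀ m {P : ℕ → Set} (P? : Decidable P) → (∀ {j} → j < m → ¬ P j) → ∑[ j < m ] 𝟙 (P? j) ≡ 0
∑-𝟙-none m P? none = trans (∑-cong m zero-at) (∑-zero m)
  where
  zero-at : ∀ {j} → j < m → 𝟙 (P? j) ≡ 0
  zero-at {j} j<m with P? j
  ... | yes Pj = ⊥-elim (none j<m Pj)
  ... | no _   = refl

module Isoperimetry {n m y h} (prof : NeighbourhoodProfile n m y h) where
  open NeighbourhoodProfile prof
  open Orientations prof

  non-full : ¬ (∃ λ j → j < m × y j ≡ n) → ∀ {j} → j < m → y j < n
  non-full no-full j<m = ≤∧≢⇒< (y≤n j<m) (λ yj≡n → no-full (_ , j<m , yj≡n))

  non-empty : ¬ (∃ λ j → j < m × y j ≡ 0) → ∀ {j} → j < m → 0 < y j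
  non-empty no-empty j<m = n≢0⇒n>0 (λ yj≡0 → no-empty (_ , j<m , yj≡0))

  few-tall-columns : 2 ≤ n → (∀ {j} → j < m → y j < n) → ∀ {z} → z < m → y z ≡ 0 → excess m y h < n →
                     ∑< m y < triangle n
  few-tall-columns 2≤n@(s≤s (s≤s _)) none-full {z} z<m yz≡0 excess<n = begin-strict
    ∑< m y                                   ≡⟨ layer-cake n m y y≤n ⟩
    ∑[ v < n ] ∑[ j < m ] 𝟙 (suc v ≤? y j)   ≤⟨ ∑-mono n (λ {v} _ → tall-bound v) ⟩
    ∑[ v < n ] (pred n ∸ suc v)              ≡⟨ ∑n∸1+v≡triangle (pred n) ⟩
    triangle (pred n)                        <⟨ m<m+n (triangle (pred n)) (s≤s⁻¹ 2≤n) ⟩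
    triangle n                               ∎
    where
    open ≤-Reasoning
    tall-bound : ∀ v → ∑[ j < m ] 𝟙 (suc v ≤? y j) ≤ pred n ∸ suc v
    tall-bound v with anyUpTo? (λ j → suc v ≤? y j) m
    ... | yes (k , k<m , 1+v≤yk) =
          m+n≤o⇒m≤o∸n _ (≤-trans (tall-columns none-full z<m k<m yz≡0 z<s 1+v≤yk) (<⇒≤pred excess<n))
    ... | no none = ≤-trans (≤-reflexive (∑-𝟙-none m _ (λ j<m 1+v≤yj → none (_ , j<m , 1+v≤yj)))) z≤n

  many-tall-columns : n ≤ m → (∀ {j} → j < m → 0 < y j) → ∀ {f} → f < m → y f ≡ n → excess m y h < n →
                      triangle n + n ≤ ∑< m y
  many-tall-columns n≤m none-empty {f} f<m yf≡n excess<n = begin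
    triangle n + n                           ≡⟨ ∑n∸v≡triangle+n n ⟨
    ∑[ v < n ] (n ∸ v)                       ≤⟨ ∑-mono n tall-bound ⟩
    ∑[ v < n ] ∑[ j < m ] 𝟙 (suc v ≤? y j)   ≡⟨ layer-cake n m y y≤n ⟨
    ∑< m y                                   ∎
    where
    open ≤-Reasoning
    short-bound : ∀ {v} → v < n → ∑[ j < m ] 𝟙 (y j <? suc v) ≤ v
    short-bound {v} v<n with anyUpTo? (λ j → y j <? suc v) m
    ... | yes (q , q<m , yq≤v) = s≤s⁻¹ (+-cancelʳ-< n _ (suc v) (begin-strict
            ∑[ j < m ] 𝟙 (y j <? suc v) + n  ≤⟨ short-columns none-empty q<m f<m yf≡n yq≤v v<n ⟩
            excess m y h + suc v             <⟨ +-monoˡ-< (suc v) excess<n ⟩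
            n + suc v                        ≡⟨ +-comm n (suc v) ⟩
            suc v + n                        ∎))
    ... | no none = ≤-trans (≤-reflexive (∑-𝟙-none m _ (λ j<m yj≤v → none (_ , j<m , yj≤v)))) z≤n
    tall+short : ∀ v → ∑[ j < m ] 𝟙 (suc v ≤? y j) + ∑[ j < m ] 𝟙 (y j <? suc v) ≡ m
    tall+short v = begin-equality
      ∑[ j < m ] 𝟙 (suc v ≤? y j) + ∑[ j < m ] 𝟙 (y j <? suc v)  ≡⟨ ∑-distrib-+ m _ _ ⟨
      ∑[ j < m ] (𝟙 (suc v ≤? y j) + 𝟙 (y j <? suc v))          ≡⟨ ∑-cong m (λ _ → 𝟙-complement (suc v) (y _)) ⟩
      ∑[ j < m ] 1                                              ≡⟨ ∑-ones m ⟩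
      m                                                         ∎
    tall-bound : ∀ {v} → v < n → n ∸ v ≤ ∑[ j < m ] 𝟙 (suc v ≤? y j)
    tall-bound {v} v<n = begin
      n ∸ v          ≤⟨ ∸-mono n≤m (short-bound v<n) ⟩
      m ∸ short      ≡⟨ cong (_∸ short) (tall+short v) ⟨
      tall + short ∸ short  ≡⟨ m+n∸n≡m tall short ⟩
      tall           ∎
      where
      tall short : ℕ
      tall  = ∑[ j < m ] 𝟙 (suc v ≤? y j)
      short = ∑[ j < m ] 𝟙 (y j <? suc v)

  isoperimetry : 2 ≤ n → n ≤ m → triangle n ≤ ∑< m y → triangle n + n ≤ ∑< m h
  isoperimetry 2≤n n≤m triangle≤∑y with n ≤? excess m y h
  ... | yes n≤excess = ≤-trans (+-mono-≤ triangle≤∑y n≤excess) (≤-reflexive (sym ∑h≡∑y+excess))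
    where
    ∑h≡∑y+excess : ∑< m h ≡ ∑< m y + excess m y h
    ∑h≡∑y+excess = trans (∑-cong m (λ j<m → sym (m+[n∸m]≡n (y≤h j<m)))) (∑-distrib-+ m y _)
  ... | no n≰excess with anyUpTo? (λ j → y j ≟ 0) m | anyUpTo? (λ j → y j ≟ n) m
  ... | yes (z , z<m , yz≡0) | yes (f , f<m , yf≡n) =
    ⊥-elim (n≰excess (empty-and-full (<-trans z<s 2≤n) z<m f<m yz≡0 yf≡n))
  ... | yes (z , z<m , yz≡0) | no no-full =
    ⊥-elim (<⇒≱ (few-tall-columns 2≤n (non-full no-full) z<m yz≡0 (≰⇒> n≰excess)) triangle≤∑y)
  ... | no no-empty | yes (f , f<m , yf≡n) =
    ≤-trans (many-tall-columns n≤m (non-empty no-empty) f<m yf≡n (≰⇒> n≰excess)) (∑-mono m y≤h)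
  ... | no no-empty | no no-full = ⊥-elim (n≰excess (≤-trans n≤m m≤excess))
    where
    m≤excess : m ≤ excess m y h
    m≤excess = subst (_≤ excess m y h) (∑-ones m)
                 (∑-mono m (λ j<m → m<n⇒0<n∸m (y<h j<m (non-empty no-empty j<m) (non-full no-full j<m))))


Region : Set
Region = ℕ → ℕ → Bool

prev : (ℕ → Bool) → ℕ → Bool
prev f zero    = false
prev f (suc i) = f i

touches : Region → Region
touches A i j = A i j ∨ A (suc i) j ∨ prev (λ x → A x j) i ∨ A i (suc j) ∨ prev (A i) j

data Near (A : Region) : ℕ → ℕ → Set where
  here     : ∀ {i j} → T (A i j)       → Near A i j
  next-row : ∀ {i j} → T (A (suc i) j) → Near A i j
  prev-row : ∀ {i j} → T (A i j)       → Near A (suc i) j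
  next-col : ∀ {i j} → T (A i (suc j)) → Near A i j
  prev-col : ∀ {i j} → T (A i j)       → Near A i (suc j)

∨-inj₁ : ∀ a {b} → T a → T (a ∨ b)
∨-inj₁ true _ = tt

∨-inj₂ : ∀ a {b} → T b → T (a ∨ b)
∨-inj₂ true  _ = tt
∨-inj₂ false p = p

near⇒touches : ∀ {A i j} → Near A i j → T (touches A i j)
near⇒touches {A} {i} {j} (here p)     = ∨-inj₁ _ p
near⇒touches {A} {i} {j} (next-row p) = ∨-inj₂ (A i j) (∨-inj₁ _ p)
near⇒touches {A} {i} {j} (prev-row p) = ∨-inj₂ (A i j) (∨-inj₂ (A (suc i) j) (∨-inj₁ _ p))
near⇒touches {A} {i} {j} (next-col p) = ∨-inj₂ (A i j) (∨-inj₂ (A (suc i) j) (∨-inj₂ (prev (λ x → A x j) i) (∨-inj₁ _ p)))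
near⇒touches {A} {i} {j} (prev-col p) =
  ∨-inj₂ (A i j) (∨-inj₂ (A (suc i) j) (∨-inj₂ (prev (λ x → A x j) i) (∨-inj₂ (A i (suc j)) p)))

private
  T-∨⁻ : ∀ {a b} → T (a ∨ b) → T a ⊎ T b
  T-∨⁻ = Equivalence.to T-∨

near-prev-row : ∀ {A} i {j} → T (prev (λ x → A x j) i) → Near A i j
near-prev-row (suc i) p = prev-row p

near-prev-col : ∀ {A i} j → T (prev (A i) j) → Near A i j
near-prev-col (suc j) p = prev-col p

touches⇒near : ∀ {A} i j → T (touches A i j) → Near A i j
touches⇒near i j t with T-∨⁻ t
... | inj₁ p = here p
... | inj₂ t with T-∨⁻ t
...   | inj₁ p = next-row p
...   | inj₂ t with T-∨⁻ t
...     | inj₁ p = near-prev-row i p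
...     | inj₂ t with T-∨⁻ t
...       | inj₁ p = next-col p
...       | inj₂ p = near-prev-col j p

⟦⟧-mono : ∀ {a b} → (T a → T b) → ⟦ a ⟧ ≤ ⟦ b ⟧
⟦⟧-mono {false}          _   = z≤n
⟦⟧-mono {true}  {true}   _   = ≤-refl
⟦⟧-mono {true}  {false} a⇒b = ⊥-elim (a⇒b tt)

⟦⟧-true : ∀ {a} → T a → ⟦ a ⟧ ≡ 1
⟦⟧-true {true} _ = refl

⟦⟧-positive : ∀ {a} → 0 < ⟦ a ⟧ → T a
⟦⟧-positive {true} _ = tt

⟦⟧-< : ∀ {a b} → ¬ T a → T b → ⟦ a ⟧ < ⟦ b ⟧
⟦⟧-< {false} {true} _ _ = ≤-refl
⟦⟧-< {true}         ¬a _ = ⊥-elim (¬a tt)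

∅ : Region
∅ _ _ = false

_∪_ : Region → Region → Region
(A ∪ B) i j = A i j ∨ B i j

_∖_ : Region → Region → Region
(A ∖ B) i j = A i j ∧ not (B i j)

cell : ℕ → ℕ → Region
cell i₀ j₀ i j = (j ≡ᵇ j₀) ∧ (i ≡ᵇ i₀)

≡ᵇ-false : ∀ {a b} → a ≢ b → (a ≡ᵇ b) ≡ false
≡ᵇ-false {a} {b} a≢b with a ≡ᵇ b in eq
... | true  = ⊥-elim (a≢b (≡ᵇ⇒≡ a b (subst T (sym eq) tt)))
... | false = refl

⟦∨⟧≤ : ∀ a b → ⟦ a ∨ b ⟧ ≤ ⟦ a ⟧ + ⟦ b ⟧
⟦∨⟧≤ true  b = s≤s z≤n
⟦∨⟧≤ false b = ≤-refl

⟦⟧≤⟦∖⟧ : ∀ a b → ⟦ a ⟧ ≤ ⟦ a ∧ not b ⟧ + ⟦ b ⟧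
⟦⟧≤⟦∖⟧ true  true  = ≤-refl
⟦⟧≤⟦∖⟧ true  false = s≤s z≤n
⟦⟧≤⟦∖⟧ false b     = z≤n

module GridRegions (n m : ℕ) where

  grid : Region
  grid i j = (i <ᵇ n) ∧ (j <ᵇ m)

  N[_] : Region → Region
  N[ A ] i j = grid i j ∧ touches A i j

  column : Region → ℕ → ℕ
  column A j = ∑[ i < n ] ⟦ A i j ⟧

  size : Region → ℕ
  size A = ∑[ j < m ] column A j

  grid-intro : ∀ {i j} → i < n → j < m → T (grid i j)
  grid-intro i<n j<m = Equivalence.from T-∧ (<⇒<ᵇ i<n , <⇒<ᵇ j<m)

  N-intro : ∀ {A i j} → i < n → j < m → Near A i j → T (N[ A ] i j)
  N-intro {A} i<n j<m near = Equivalence.from T-∧ (grid-intro i<n j<m , near⇒touches near)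

  column≤n : ∀ A j → column A j ≤ n
  column≤n A j = ≤-trans (∑-mono n (λ _ → ⟦⟧≤1 (A _ j))) (≤-reflexive (∑-ones n))

  column-mono : ∀ A B {j j′} → (∀ {i} → i < n → T (A i j) → T (B i j′)) → column A j ≤ column B j′
  column-mono A B A⇒B = ∑-mono n (λ i<n → ⟦⟧-mono (A⇒B i<n))

  boundary-cell : ∀ A j → 0 < column A j → column A j < n → ∃[ p ] (p < n × ¬ T (A p j) × Near A p j)
  boundary-cell A j 0<col col<n with ∑-positive n _ 0<col | anyUpTo? (λ i → ¬? (T? (A i j))) n
  ... | _ | no all-in = ⊥-elim (<⇒≢ col<n (trans (∑-cong n (⟦⟧-true ∘ in-column)) (∑-ones n)))
    where
    in-column : ∀ {i} → i < n → T (A i j)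
    in-column {i} i<n with T? (A i j)
    ... | yes a = a
    ... | no ¬a = ⊥-elim (all-in (i , i<n , ¬a))
  ... | i₁ , i₁<n , 0<a₁ | yes (i₀ , i₀<n , ¬a₀) with <-cmp i₀ i₁
  ...   | tri< i₀<i₁ _ _ =
          let (p , i₀≤p , p<i₁ , a[1+p] , outside) = first-switch (λ i → T? (A i j)) i₀<i₁ ¬a₀ (⟦⟧-positive 0<a₁)
          in p , <-trans p<i₁ i₁<n , outside i₀≤p ≤-refl , next-row a[1+p]
  ...   | tri≈ _ refl _ = ⊥-elim (¬a₀ (⟦⟧-positive 0<a₁))
  ...   | tri> _ _ i₁<i₀ =
          let (p , _ , p<i₀ , a[p] , outside) = last-switch (λ i → T? (A i j)) i₀ i₁<i₀ (⟦⟧-positive 0<a₁) ¬a₀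
          in suc p , ≤-<-trans p<i₀ i₀<n , outside ≤-refl p<i₀ , prev-row a[p]

  column-profile : ∀ A → NeighbourhoodProfile n m (column A) (column N[ A ])
  column-profile A = record
    { y≤n         = λ {j} _ → column≤n A j
    ; y≤h         = λ j<m → column-mono A N[ A ] (λ i<n → N-intro {A} i<n j<m ∘ here)
    ; y<h         = grows
    ; y[1+j]≤h[j] = λ 1+j<m → column-mono A N[ A ] (λ i<n → N-intro {A} i<n (<-trans (n<1+n _) 1+j<m) ∘ next-col)
    ; y[j]≤h[1+j] = λ 1+j<m → column-mono A N[ A ] (λ i<n → N-intro {A} i<n 1+j<m ∘ prev-col)
    }
    where
    grows : ∀ {j} → j < m → 0 < column A j → column A j < n → column A j < column N[ A ] j
    grows {j} j<m 0<col col<n =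
      let (p , p<n , ¬a[p] , near) = boundary-cell A j 0<col col<n
      in ∑-strict-mono n (λ i<n → ⟦⟧-mono (N-intro {A} i<n j<m ∘ here)) p<n (⟦⟧-< ¬a[p] (N-intro {A} p<n j<m near))

  grid-isoperimetry : 2 ≤ n → n ≤ m → ∀ A → triangle n ≤ size A → triangle n + n ≤ size N[ A ]
  grid-isoperimetry 2≤n n≤m A = Isoperimetry.isoperimetry (column-profile A) 2≤n n≤m

  size-subadditive : ∀ {A B C : Region} → (∀ i j → ⟦ A i j ⟧ ≤ ⟦ B i j ⟧ + ⟦ C i j ⟧) → size A ≤ size B + size C
  size-subadditive {A} {B} {C} le = begin
    size A                                                   ≤⟨ ∑-mono m (λ {j} _ → ∑-mono n (λ {i} _ → le i j)) ⟩
    ∑[ j < m ] ∑[ i < n ] (⟦ B i j ⟧ + ⟦ C i j ⟧)             ≡⟨ ∑-cong m (λ {j} _ → ∑-distrib-+ n _ _) ⟩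
    ∑[ j < m ] (column B j + column C j)                     ≡⟨ ∑-distrib-+ m _ _ ⟩
    size B + size C                                          ∎
    where open ≤-Reasoning

  size-cell : ∀ i₀ j₀ → size (cell i₀ j₀) ≤ 1
  size-cell i₀ j₀ = begin
    size (cell i₀ j₀)                        ≤⟨ ∑-point m other-column ⟩
    ∑[ i < n ] ⟦ (j₀ ≡ᵇ j₀) ∧ (i ≡ᵇ i₀) ⟧     ≡⟨ ∑-cong n (λ {i} _ → cong (λ b → ⟦ b ∧ (i ≡ᵇ i₀) ⟧) (≡ᵇ-true j₀)) ⟩
    ∑[ i < n ] ⟦ i ≡ᵇ i₀ ⟧                   ≤⟨ ∑-point n (λ i≢i₀ → cong ⟦_⟧ (≡ᵇ-false i≢i₀)) ⟩
    ⟦ i₀ ≡ᵇ i₀ ⟧                             ≤⟨ ⟦⟧≤1 (i₀ ≡ᵇ i₀) ⟩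
    1                                        ∎
    where
    open ≤-Reasoning
    ≡ᵇ-true : ∀ a → (a ≡ᵇ a) ≡ true
    ≡ᵇ-true a = Equivalence.to T-≡ (≡⇒≡ᵇ a a refl)
    other-column : ∀ {j} → j ≢ j₀ → column (cell i₀ j₀) j ≡ 0
    other-column {j} j≢j₀ rewrite ≡ᵇ-false j≢j₀ = ∑-zero n

  size-∅ : size ∅ ≡ 0
  size-∅ = trans (∑-cong m (λ _ → ∑-zero n)) (∑-zero m)

  size-grid : size grid ≡ m * n
  size-grid = trans (∑-cong m (λ j<m → trans (∑-cong n (λ i<n → ⟦⟧-true (grid-intro i<n j<m)))
                                             (∑-ones n)))
                    (∑-const m n)


∣x-1+x∣≡1 : ∀ x → ∣ x - suc x ∣ ≡ 1
∣x-1+x∣≡1 zero    = refl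
∣x-1+x∣≡1 (suc x) = ∣x-1+x∣≡1 x

∣1+x-x∣≡1 : ∀ x → ∣ suc x - x ∣ ≡ 1
∣1+x-x∣≡1 x = trans (∣-∣-comm (suc x) x) (∣x-1+x∣≡1 x)

module _ {A : Set} where

  extend : (ℕ → A) → ℕ → A → ℕ → A
  extend w t₀ v t with t ≤? t₀
  ... | yes _ = w t
  ... | no _  = v

  extend-≤ : ∀ w {t₀} v {t} → t ≤ t₀ → extend w t₀ v t ≡ w t
  extend-≤ w {t₀} v {t} t≤t₀ with t ≤? t₀
  ... | yes _   = refl
  ... | no t≰t₀ = ⊥-elim (t≰t₀ t≤t₀)

  extend-suc : ∀ w t₀ v → extend w t₀ v (suc t₀) ≡ v
  extend-suc w t₀ v with suc t₀ ≤? t₀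
  ... | yes 1+t₀≤t₀ = ⊥-elim (<-irrefl refl 1+t₀≤t₀)
  ... | no _        = refl

extend-walk : ∀ (G : Graph) {w t₀ v} → IsWalk G w → v ≡ w t₀ ⊎ Adj G (w t₀) v → IsWalk G (extend w t₀ v)
extend-walk G {w} {t₀} {v} walk last-move t with suc t ≤? t₀ | t ≤? t₀
... | yes _      | yes _   = walk t
... | yes 1+t≤t₀ | no t≰t₀ = ⊥-elim (t≰t₀ (<⇒≤ 1+t≤t₀))
... | no 1+t≰t₀  | yes t≤t₀ rewrite ≤-antisym t≤t₀ (s≤s⁻¹ (≰⇒> 1+t≰t₀)) = last-move
... | no _       | no _    = inj₁ refl

near-step : ∀ {A i j} → Near A i j →
            ∃ λ i′ → ∃ λ j′ → T (A i′ j′) × ((i′ ≡ i × j′ ≡ j) ⊎ ∣ i′ - i ∣ + ∣ j′ - j ∣ ≡ 1)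
near-step             (here a)     = _ , _ , a , inj₁ (refl , refl)
near-step {i = i} {j} (next-row a) = _ , _ , a , inj₂ (cong₂ _+_ (∣1+x-x∣≡1 i) (∣n-n∣≡0 j))
near-step {i = suc i} {j} (prev-row a) = _ , _ , a , inj₂ (cong₂ _+_ (∣x-1+x∣≡1 i) (∣n-n∣≡0 j))
near-step {i = i} {j} (next-col a) = _ , _ , a , inj₂ (cong₂ _+_ (∣n-n∣≡0 i) (∣1+x-x∣≡1 j))
near-step {i = i} {suc j} (prev-col a) = _ , _ , a , inj₂ (cong₂ _+_ (∣n-n∣≡0 i) (∣x-1+x∣≡1 j))

module Vertices (n m : ℕ) where
  open GridRegions n m

  Vertex : Set
  Vertex = Fin n × Fin m

  _∈_ : Vertex → Region → Set
  (a , b) ∈ A = T (A (toℕ a) (toℕ b))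

  cell-of : Vertex → Region
  cell-of (a , b) = cell (toℕ a) (toℕ b)

  cell-of-∋ : ∀ v → v ∈ cell-of v
  cell-of-∋ (a , b) = Equivalence.from T-∧ (≡⇒≡ᵇ (toℕ b) (toℕ b) refl , ≡⇒≡ᵇ (toℕ a) (toℕ a) refl)

  ∈-∪ˡ : ∀ A B v → v ∈ A → v ∈ (A ∪ B)
  ∈-∪ˡ A B (a , b) = ∨-inj₁ (A (toℕ a) (toℕ b))

  ∈-∪ʳ : ∀ A B v → v ∈ B → v ∈ (A ∪ B)
  ∈-∪ʳ A B (a , b) = ∨-inj₂ (A (toℕ a) (toℕ b))

  cells : ∀ {k} → (Fin k → Vertex) → Region
  cells {zero}  p = ∅
  cells {suc k} p = cell-of (p zero) ∪ cells (p ∘ suc)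

  cells-∋ : ∀ {k} (p : Fin k → Vertex) r → p r ∈ cells p
  cells-∋ p zero    = ∈-∪ˡ (cell-of (p zero)) (cells (p ∘ suc)) (p zero) (cell-of-∋ (p zero))
  cells-∋ p (suc r) = ∈-∪ʳ (cell-of (p zero)) (cells (p ∘ suc)) (p (suc r)) (cells-∋ (p ∘ suc) r)

  size-cells : ∀ {k} (p : Fin k → Vertex) → size (cells p) ≤ k
  size-cells {zero}  p = ≤-reflexive size-∅
  size-cells {suc k} p = begin
    size (cells p)                                ≤⟨ size-subadditive (λ i j → ⟦∨⟧≤ (cell-of (p zero) i j) (cells (p ∘ suc) i j)) ⟩
    size (cell-of (p zero)) + size (cells (p ∘ suc)) ≤⟨ +-mono-≤ (size-cell _ _) (size-cells (p ∘ suc)) ⟩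
    suc k                                         ∎
    where open ≤-Reasoning

  vertex-at : ∀ {A : Region} {i j} (i<n : i < n) (j<m : j < m) → T (A i j) → (fromℕ< i<n , fromℕ< j<m) ∈ A
  vertex-at {A} i<n j<m a = subst₂ (λ x y → T (A x y)) (sym (toℕ-fromℕ< i<n)) (sym (toℕ-fromℕ< j<m)) a

  InGrid : Region → Set
  InGrid A = ∀ {i j} → T (A i j) → i < n × j < m

  located : ∀ {A} → InGrid A → ∀ {i j} → T (A i j) → ∃ λ u → u ∈ A × toℕ (proj₁ u) ≡ i × toℕ (proj₂ u) ≡ j
  located {A} in-grid a = let (i<n , j<m) = in-grid a in
    (fromℕ< i<n , fromℕ< j<m) , vertex-at {A} i<n j<m a , toℕ-fromℕ< i<n , toℕ-fromℕ< j<m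

  predecessor : ∀ {A} → InGrid A → ∀ v → Near A (toℕ (proj₁ v)) (toℕ (proj₂ v)) →
                ∃ λ u → u ∈ A × (v ≡ u ⊎ Adj (Grid n m) u v)
  predecessor in-grid v near with near-step near
  ... | i′ , j′ , a′ , step with located in-grid a′
  ...   | u , u∈A , refl , refl = u , u∈A , vertex-step step
    where
    vertex-step : (toℕ (proj₁ u) ≡ toℕ (proj₁ v) × toℕ (proj₂ u) ≡ toℕ (proj₂ v)) ⊎ Adj (Grid n m) u v →
                  v ≡ u ⊎ Adj (Grid n m) u v
    vertex-step (inj₁ (eq₁ , eq₂)) = inj₁ (×-≡,≡→≡ (toℕ-injective (sym eq₁) , toℕ-injective (sym eq₂)))
    vertex-step (inj₂ adj)         = inj₂ adj

module Evasion {n m k : ℕ} (σ : Strategy (Grid n m) k) where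
  open GridRegions n m
  open Vertices n m

  inspected : ℕ → Region
  inspected t with t <? len σ
  ... | yes t<len = cells (pick (round σ (fromℕ< t<len)))
  ... | no _      = ∅

  -- possible t: where an intruder not caught before round t can be at round t.
  possible survivors : ℕ → Region
  possible zero    = grid
  possible (suc t) = N[ survivors t ]
  survivors t = possible t ∖ inspected t

  inspected-∋ : ∀ (t : Fin (len σ)) r → pick (round σ t) r ∈ inspected (toℕ t)
  inspected-∋ t r with toℕ t <? len σ
  ... | yes t<len rewrite fromℕ<-toℕ t t<len = cells-∋ (pick (round σ t)) r
  ... | no t≮len  = ⊥-elim (t≮len (toℕ<n t))

  size-inspected : ∀ t → size (inspected t) ≤ k
  size-inspected t with t <? len σ
  ... | yes t<len = size-cells (pick (round σ (fromℕ< t<len)))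
  ... | no _      = ≤-trans (≤-reflexive size-∅) z≤n

  possible-in-grid : ∀ t → InGrid (possible t)
  possible-in-grid zero    g = let (i<n , j<m) = Equivalence.to T-∧ g in <ᵇ⇒< _ _ i<n , <ᵇ⇒< _ _ j<m
  possible-in-grid (suc t) N = possible-in-grid zero (proj₁ (Equivalence.to T-∧ N))

  survivors⊆possible : ∀ {t i j} → T (survivors t i j) → T (possible t i j)
  survivors⊆possible s = proj₁ (Equivalence.to T-∧ s)

  survivors-in-grid : ∀ t → InGrid (survivors t)
  survivors-in-grid t = possible-in-grid t ∘ survivors⊆possible {t}

  survivors-uninspected : ∀ {t i j} → T (survivors t i j) → ¬ T (inspected t i j)
  survivors-uninspected {t} {i} {j} s with inspected t i j
  ... | true  = λ _ → proj₂ (Equivalence.to (T-∧ {possible t i j}) s)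
  ... | false = λ ()

  module Invariant (2≤n : 2 ≤ n) (n≤m : n ≤ m) (k≤n : k ≤ n) where

    possible-large : ∀ t → triangle n + n ≤ size (possible t)
    survivors-large : ∀ t → triangle n ≤ size (survivors t)

    possible-large zero = begin
      triangle n + n   ≤⟨ triangle+n≤n*n n ⟩
      n * n            ≤⟨ *-monoˡ-≤ n n≤m ⟩
      m * n            ≡⟨ size-grid ⟨
      size grid        ∎
      where open ≤-Reasoning
    possible-large (suc t) = grid-isoperimetry 2≤n n≤m (survivors t) (survivors-large t)

    survivors-large t = +-cancelʳ-≤ n _ _ (begin
      triangle n + n                           ≤⟨ possible-large t ⟩
      size (possible t)                        ≤⟨ size-subadditive (λ i j → ⟦⟧≤⟦∖⟧ (possible t i j) (inspected t i j)) ⟩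
      size (survivors t) + size (inspected t)  ≤⟨ +-monoʳ-≤ _ (≤-trans (size-inspected t) k≤n) ⟩
      size (survivors t) + n                   ∎)
      where open ≤-Reasoning

    some-survivor : ∀ t → ∃ λ v → v ∈ survivors t
    some-survivor t with ∑-positive m _ (<-≤-trans (triangle-positive 2≤n) (survivors-large t))
    ... | j , _ , 0<column with ∑-positive n _ 0<column
    ...   | i , _ , 0<cell =
            let (v , v∈ , _) = located {survivors t} (survivors-in-grid t) (⟦⟧-positive 0<cell) in v , v∈

    evading-walk : ∀ t₀ v → v ∈ survivors t₀ →
                   ∃ λ w → IsWalk (Grid n m) w × w t₀ ≡ v × (∀ {t} → t ≤ t₀ → w t ∈ survivors t)
    evading-walk zero     v v∈ = (λ _ → v) , (λ _ → inj₁ refl) , refl , λ { z≤n → v∈ }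
    evading-walk (suc t₀) v v∈
      with predecessor (survivors-in-grid t₀) v
             (touches⇒near _ _ (proj₂ (Equivalence.to T-∧ (survivors⊆possible {suc t₀} v∈))))
    ... | u , u∈ , move with evading-walk t₀ u u∈
    ...   | w , walk , w[t₀]≡u , safe =
            extend w t₀ v , extend-walk (Grid n m) walk (subst (λ x → v ≡ x ⊎ Adj (Grid n m) x v) (sym w[t₀]≡u) move) ,
            extend-suc w t₀ v , safe′
      where
      safe′ : ∀ {t} → t ≤ suc t₀ → extend w t₀ v t ∈ survivors t
      safe′ {t} t≤1+t₀ with m≤n⇒m<n∨m≡n t≤1+t₀
      ... | inj₁ t<1+t₀ = subst (_∈ survivors t) (sym (extend-≤ w v (s≤s⁻¹ t<1+t₀))) (safe (s≤s⁻¹ t<1+t₀))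
      ... | inj₂ refl   = subst (_∈ survivors (suc t₀)) (sym (extend-suc w t₀ v)) v∈

    evasion : ∃ λ w → IsWalk (Grid n m) w × ¬ Catches (Grid n m) σ w
    evasion with some-survivor (len σ)
    ... | v , v∈ with evading-walk (len σ) v v∈
    ...   | w , walk , _ , safe = w , walk , λ (t , r , caught) →
            survivors-uninspected (safe (<⇒≤ (toℕ<n t))) (subst (_∈ inspected (toℕ t)) caught (inspected-∋ t r))


module Sweep {n m : ℕ} (1≤n : 1 ≤ n) (2≤m : 2 ≤ m) where
  open Vertices n m using (Vertex)

  encode : Vertex → Fin (m * n)
  encode (a , b) = combine b a

  decode : Fin (m * n) → Vertex
  decode = swap ∘ remQuot n

  -- index (a , b) = n * toℕ b + toℕ a, by toℕ-combine.
  index : Vertex → ℕ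
  index = toℕ ∘ encode

  decode-encode : ∀ v → decode (encode v) ≡ v
  decode-encode (a , b) = cong swap (remQuot-combine b a)

  index-decode : ∀ x → index (decode x) ≡ toℕ x
  index-decode x = cong toℕ (combine-remQuot {m} n x)

  index<mn : ∀ v → index v < m * n
  index<mn = toℕ<n ∘ encode

  index-injective : ∀ {u v} → index u ≡ index v → u ≡ v
  index-injective {u} {v} eq = begin
    u                 ≡⟨ decode-encode u ⟨
    decode (encode u) ≡⟨ cong decode (toℕ-injective eq) ⟩
    decode (encode v) ≡⟨ decode-encode v ⟩
    v                 ∎
    where open ≡-Reasoning

  index-step : ∀ u v → Adj (Grid n m) u v → index u ≤ index v + n
  index-step (a , b) (c , d) adj rewrite toℕ-combine b a | toℕ-combine d c = begin
    n * toℕ b + toℕ a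
      ≤⟨ +-mono-≤ (*-monoʳ-≤ n (m≤n+∣m-n∣ (toℕ b) (toℕ d))) (m≤n+∣m-n∣ (toℕ a) (toℕ c)) ⟩
    n * (toℕ d + δb) + (toℕ c + δa)         ≡⟨ shuffle n (toℕ d) (toℕ c) δa δb ⟩
    n * toℕ d + toℕ c + (n * δb + δa)       ≤⟨ +-monoʳ-≤ (n * toℕ d + toℕ c) (+-monoʳ-≤ (n * δb) δa≤nδa) ⟩
    n * toℕ d + toℕ c + (n * δb + n * δa)   ≡⟨ cong (n * toℕ d + toℕ c +_) (*-distribˡ-+ n δb δa) ⟨
    n * toℕ d + toℕ c + n * (δb + δa)       ≡⟨ cong (λ x → n * toℕ d + toℕ c + n * x) (trans (+-comm δb δa) adj) ⟩
    n * toℕ d + toℕ c + n * 1               ≡⟨ cong (n * toℕ d + toℕ c +_) (*-identityʳ n) ⟩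
    n * toℕ d + toℕ c + n                   ∎
    where
    open ≤-Reasoning
    δa = ∣ toℕ a - toℕ c ∣
    δb = ∣ toℕ b - toℕ d ∣
    δa≤nδa : δa ≤ n * δa
    δa≤nδa = subst (_≤ n * δa) (*-identityˡ δa) (*-monoˡ-≤ δa 1≤n)
    shuffle : ∀ n d c x y → n * (d + y) + (c + x) ≡ (n * d + c) + (n * y + x)
    shuffle = +-*-Solver.solve 5 (λ n d c x y → n :* (d :+ y) :+ (c :+ x) := (n :* d :+ c) :+ (n :* y :+ x)) refl
      where open +-*-Solver

  rounds : ℕ
  rounds = m * n ∸ n

  n<mn : n < m * n
  n<mn = begin-strict
    n          <⟨ m<m+n n 1≤n ⟩
    n + n      ≡⟨ cong (n +_) (+-identityʳ n) ⟨
    2 * n      ≤⟨ *-monoˡ-≤ n 2≤m ⟩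
    m * n      ∎
    where open ≤-Reasoning

  window-< : ∀ {t r} → t < rounds → r ≤ n → t + r < m * n
  window-< {t} {r} t<rounds r≤n = begin-strict
    t + r        <⟨ +-mono-<-≤ t<rounds r≤n ⟩
    rounds + n   ≡⟨ m∸n+n≡m (<⇒≤ n<mn) ⟩
    m * n        ∎
    where open ≤-Reasoning

  window-cell : Fin rounds → Fin (suc n) → Vertex
  window-cell t r = decode (fromℕ< (window-< (toℕ<n t) (s≤s⁻¹ (toℕ<n r))))

  index-window-cell : ∀ t r → index (window-cell t r) ≡ toℕ t + toℕ r
  index-window-cell t r = trans (index-decode _) (toℕ-fromℕ< _)

  window : Fin rounds → Inspection (Grid n m) (suc n)
  window t = record
    { pick     = window-cell t
    ; distinct = λ {r} {r′} eq → toℕ-injective (+-cancelˡ-≡ (toℕ t) (toℕ r) (toℕ r′)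
                   (trans (sym (index-window-cell t r)) (trans (cong index eq) (index-window-cell t r′))))
    }

  last : ℕ
  last = pred rounds

  1+last≡rounds : suc last ≡ rounds
  1+last≡rounds = suc-pred rounds {{>-nonZero (m<n⇒0<n∸m n<mn)}}

  last<rounds : last < rounds
  last<rounds = ≤-reflexive 1+last≡rounds

  sweep : Strategy (Grid n m) (suc n)
  sweep = record { len = rounds ; round = window }

  module _ (w : ℕ → Vertex) (walk : IsWalk (Grid n m) w) where

    caught-in-window : ∀ {t} → t < rounds → t ≤ index (w t) → index (w t) ≤ t + n → Catches (Grid n m) sweep w
    caught-in-window {t} t<rounds t≤index index≤t+n =
      fromℕ< t<rounds , fromℕ< r<1+n , index-injective (begin
        index (window-cell (fromℕ< t<rounds) (fromℕ< r<1+n))  ≡⟨ index-window-cell (fromℕ< t<rounds) (fromℕ< r<1+n) ⟩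
        toℕ (fromℕ< t<rounds) + toℕ (fromℕ< r<1+n)           ≡⟨ cong₂ _+_ (toℕ-fromℕ< t<rounds) (toℕ-fromℕ< r<1+n) ⟩
        t + (index (w t) ∸ t)                                ≡⟨ m+[n∸m]≡n t≤index ⟩
        index (w t)                                          ≡⟨ cong (index ∘ w) (toℕ-fromℕ< t<rounds) ⟨
        index (w (toℕ (fromℕ< t<rounds)))                    ∎)
      where
      open ≡-Reasoning
      r<1+n : index (w t) ∸ t < suc n
      r<1+n = s≤s (m≤n+o⇒m∸n≤o (index (w t)) t index≤t+n)

    ahead-of-window : ∀ t → t < rounds → Catches (Grid n m) sweep w ⊎ t ≤ index (w t)
    ahead-of-window zero    _ = inj₂ z≤n
    ahead-of-window (suc t) 1+t<rounds with ahead-of-window t (<-trans (n<1+n t) 1+t<rounds)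
    ... | inj₁ caught = inj₁ caught
    ... | inj₂ t≤index with index (w t) ≤? t + n
    ...   | yes index≤t+n = inj₁ (caught-in-window (<-trans (n<1+n t) 1+t<rounds) t≤index index≤t+n)
    ...   | no index≰t+n  = inj₂ (+-cancelʳ-≤ n (suc t) _ (≤-trans (≰⇒> index≰t+n) (moves-slowly (walk t))))
      where
      moves-slowly : w (suc t) ≡ w t ⊎ Adj (Grid n m) (w t) (w (suc t)) → index (w t) ≤ index (w (suc t)) + n
      moves-slowly (inj₁ stay) = ≤-trans (≤-reflexive (cong index (sym stay))) (m≤m+n _ n)
      moves-slowly (inj₂ adj)  = index-step (w t) (w (suc t)) adj

    sweep-catches : Catches (Grid n m) sweep w
    sweep-catches with ahead-of-window last last<rounds
    ... | inj₁ caught    = caught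
    ... | inj₂ last≤index = caught-in-window last<rounds last≤index (s≤s⁻¹ (begin-strict
          index (w last)     <⟨ index<mn (w last) ⟩
          m * n              ≡⟨ m∸n+n≡m (<⇒≤ n<mn) ⟨
          rounds + n         ≡⟨ cong (_+ n) 1+last≡rounds ⟨
          suc last + n       ∎))
      where open ≤-Reasoning

  sweep-wins : SearcherWins (Grid n m) (suc n)
  sweep-wins = sweep , sweep-catches

transpose-adjacent : ∀ {n m} (u v : Fin m × Fin n) → Adj (Grid m n) u v → Adj (Grid n m) (swap u) (swap v)
transpose-adjacent (a , b) (c , d) adj = trans (+-comm ∣ toℕ b - toℕ d ∣ ∣ toℕ a - toℕ c ∣) adj

transpose-walk : ∀ {n m w} → IsWalk (Grid m n) w → IsWalk (Grid n m) (swap ∘ w)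
transpose-walk {w = w} walk t with walk t
... | inj₁ stay = inj₁ (cong swap stay)
... | inj₂ adj  = inj₂ (transpose-adjacent (w t) (w (suc t)) adj)

transpose-wins : ∀ {n m k} → SearcherWins (Grid n m) k → SearcherWins (Grid m n) k
transpose-wins {n} {m} {k} (σ , wins) = σᵀ , λ w walk → caught w (wins (swap ∘ w) (transpose-walk walk))
  where
  σᵀ : Strategy (Grid m n) k
  σᵀ = record { len = len σ ; round = λ t → record
         { pick = swap ∘ pick (round σ t) ; distinct = distinct (round σ t) ∘ cong swap } }
  caught : ∀ w → Catches (Grid n m) σ (swap ∘ w) → Catches (Grid m n) σᵀ w
  caught w (t , r , eq) = t , r , cong swap eq

transpose-inspection-number : ∀ {n m k} → IsInspectionNumber (Grid n m) k → IsInspectionNumber (Grid m n) k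
transpose-inspection-number (wins , least) = transpose-wins wins , λ j → least j ∘ transpose-wins

grid-inspection-number : ∀ {n m} → 2 ≤ n → n ≤ m → IsInspectionNumber (Grid n m) (suc n)
grid-inspection-number {n} {m} 2≤n n≤m = Sweep.sweep-wins (<-trans z<s 2≤n) (≤-trans 2≤n n≤m) , least
  where
  least : ∀ k → SearcherWins (Grid n m) k → suc n ≤ k
  least k (σ , wins) with suc n ≤? k
  ... | yes n<k = n<k
  ... | no n≮k  = let (w , walk , evades) = Evasion.Invariant.evasion σ 2≤n n≤m (s≤s⁻¹ (≰⇒> n≮k))
                  in ⊥-elim (evades (wins w walk))

theorem3p3 : ∀ (n m : ℕ) → 2 ≤ n → 2 ≤ m → IsInspectionNumber (Grid n m) (suc (n ⊓ m))
theorem3p3 n m 2≤n 2≤m with ≤-total n m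
... | inj₁ n≤m = subst (IsInspectionNumber (Grid n m) ∘ suc) (sym (m≤n⇒m⊓n≡m n≤m))
                       (grid-inspection-number 2≤n n≤m)
... | inj₂ m≤n = subst (IsInspectionNumber (Grid n m) ∘ suc) (sym (m≥n⇒m⊓n≡n m≤n))
                       (transpose-inspection-number (grid-inspection-number 2≤m m≤n))
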